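{- Let $k$ be a nonnegative integer and let $h \geq 2$ be an integer. Put $m = 2^{\lfloor \log_2 h \rfloor}(4k+3)$ and $n = \sum_{i=0}^{h} \binom{m}{i}$. Then \[\nu^\wedge(\mathbb{Z}_n, m, [0,h]) < \min\left\{n, \sum_{i=0}^{h}\binom{m}{i}\right\}.\]
   Context: $\mathbb{Z}_n$ denotes the additive cyclic group of order $n$, and $\lfloor x \rfloor$ is the greatest integer $\le x$. For a finite subset $A = \{a_1,\dots,a_m\}$ (with $m$ distinct elements) of an additive abelian group $G$ and an integer $h \ge 0$, define $[0,h]^\wedge A = \{\sum_{i=1}^m \lambda_i a_i : \lambda_i \in \{0,1\},\ \sum_{i=1}^m \lambda_i \in \{0,1,\dots,h\}\}$, i.e. the set of all sums of at most $h$ distinct elements of $A$ (the empty sum being $0$). For positive integers $m,h$, $\nu^\wedge(G,m,[0,h]) = \max\{|[0,h]^\wedge A| : A \subseteq G,\ |A| = m\}$. -}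

module Defs where

open import Data.Nat using (ℕ; zero; suc; _+_; _*_; _^_; _≤_; _<_; NonZero; _⊓_; _≟_)
open import Data.Nat.DivMod using (_%_)
open import Data.Nat.Logarithm using (⌊log₂_⌋)
open import Data.Nat.Combinatorics using (_C_)
open import Data.Bool using (Bool; true; false)
open import Data.Fin using (Fin; toℕ)
open import Data.Vec using (Vec; []; _∷_)
open import Data.List using (List; []; _∷_; map; length; filter; allFin; _++_)
open import Data.List.Relation.Unary.Any using (any?)
open import Function.Definitions using (Injective)
open import Data.Vec using (lookup; tabulate)
open import Data.Vec.Relation.Unary.AllPairs using (allPairs?)
open import Data.Fin.Properties using () renaming (_≟_ to _≟F_)
open import Relation.Nullary using (¬?)
open import Data.Nat using (_⊔_)
open import Relation.Binary.PropositionalEquality using (_≡_)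

sumTo : ℕ → (ℕ → ℕ) → ℕ
sumTo zero    f = f 0
sumTo (suc h) f = f 0 + sumTo h (λ i → f (suc i))

binomSum : ℕ → ℕ → ℕ
binomSum m h = sumTo h (λ i → m C i)

allChoices : (m : ℕ) → List (Vec Bool m)
allChoices zero    = [] ∷ []
allChoices (suc m) = map (true ∷_) (allChoices m) ++ map (false ∷_) (allChoices m)

weight : ∀ {m} → Vec Bool m → ℕ
weight []           = 0
weight (true  ∷ bs) = suc (weight bs)
weight (false ∷ bs) = weight bs

-- Σ λ_i a_i computed in ℕ on representatives (a_i ∈ Z_n represented by toℕ)
lsum : ∀ {m n} → Vec Bool m → (Fin m → Fin n) → ℕ
lsum []           a = 0
lsum (true  ∷ bs) a = toℕ (a Fin.zero) + lsum bs (λ i → a (Fin.suc i))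
lsum (false ∷ bs) a = lsum bs (λ i → a (Fin.suc i))

-- the elements of [0,h]^∧ A as residues in {0,…,n-1}, with repetitions
restrictedSums : ∀ {m} (n : ℕ) .{{_ : NonZero n}} → ℕ → (Fin m → Fin n) → List ℕ
restrictedSums {m} n h a =
  map (λ bs → lsum bs a % n) (filter (λ bs → weight bs Data.Nat.≤? h) (allChoices m))

allVecs : (n m : ℕ) → List (Vec (Fin n) m)
allVecs n zero    = [] ∷ []
allVecs n (suc m) = Data.List.concatMap (λ x → map (x ∷_) (allVecs n m)) (allFin n)

-- the m-element subsets A = {a_1,…,a_m} of Z_n, as vectors with distinct entries
mSubsets : (n m : ℕ) → List (Vec (Fin n) m)
mSubsets n m = filter (allPairs? (λ x y → ¬? (x ≟F y))) (allVecs n m)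

restrictedSumsetSize : ∀ {m} (n : ℕ) .{{_ : NonZero n}} → ℕ → (Fin m → Fin n) → ℕ
restrictedSumsetSize n h a =
  length (filter (λ x → any? (λ y → toℕ x ≟ y) (restrictedSums n h a)) (allFin n))

mOf : ℕ → ℕ → ℕ
mOf k h = 2 ^ ⌊log₂ h ⌋ * (4 * k + 3)

binomSum-nonZero : ∀ m h → NonZero (binomSum m h)
binomSum-nonZero m zero    = _
binomSum-nonZero m (suc h) = _

-- ν^∧(Z_n, m, [0,h]) = max { |[0,h]^∧ A| : A ⊆ Z_n, |A| = m }
-- (the maximum over an empty family is taken to be 0; irrelevant when m ≤ n)
νZ : (n : ℕ) .{{_ : NonZero n}} → (m h : ℕ) → ℕ
νZ n m h = Data.List.foldr (λ A r → restrictedSumsetSize n h (lookup A) ⊔ r) 0 (mSubsets n m)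

-- If [0,h]^∧A were all of ℤ_n, then, since n = Σ_{i ≤ h} C(m,i) is also the number of choices of
-- at most h of the a_i, the n restricted sums would be the residues 0, …, n − 1, each exactly once,
-- with total n(n − 1)/2. On the other hand each a_i occurs in Σ_{i < h} C(m − 1,i) of the sums.
-- For m = 2^t w with w ≡ 3 (mod 4) and 2^t ≤ h < 2^{t+1}, the congruences
-- C(2a,2b) ≡ C(a,b) and C(2a,2b+1) ≡ 2a C(a − 1,b) (mod 4) show that n ≡ 2 (mod 4) and that
-- Σ_{i < h} C(m − 1,i) is even. Reducing modulo 2, which divides n, the total is then both odd and even.

module Submission where

open import Defs
open import Data.Bool using (Bool; true; false)
open import Data.Empty using (⊥-elim)
open import Data.Fin using (Fin; zero; suc; toℕ; fromℕ<)
open import Data.Fin.Properties using (toℕ-fromℕ<)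
open import Data.List using (List; []; _∷_; _++_; map; length; filter; foldr; allFin)
open import Data.List.Properties using (filter-++; filter-none; filter-notAll; length-map; length-++; length-tabulate; map-∘; map-++)
open import Data.List.Membership.Propositional using (_∈_)
open import Data.List.Membership.Propositional.Properties using (∈-∃++; ∈-allFin)
open import Data.List.Relation.Unary.All using (all?)
import Data.List.Relation.Unary.All as All
open import Data.List.Relation.Unary.All.Properties using (¬All⇒Any¬)
import Data.List.Relation.Unary.All.Properties as All
open import Data.List.Relation.Unary.Any using (here; there; any?)
open import Data.List.Relation.Unary.Any.Properties using (++⁻; ++⁺ˡ; ++⁺ʳ)
open import Data.Nat using (ℕ; zero; suc; pred; _+_; _*_; _^_; _⊓_; _⊔_; ⌊_/2⌋; _≤_; _<_; z≤n; s≤s; z<s; s≤s⁻¹; _≟_; _≤?_; NonZero; >-nonZero; >-nonZero⁻¹)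
open import Data.Nat.Properties using (suc-injective; +-suc; +-assoc; +-comm; +-identityʳ; *-suc; *-assoc; *-comm; *-identityʳ; *-zeroʳ; *-distribˡ-+; *-distribʳ-+; *-cancelˡ-≤; *-cancelˡ-<; *-monoʳ-≤; m*n≢0; m^n≢0; m^n>0; ≤-reflexive; <-trans; <-≤-trans; <-irrefl; <⇒≱; n<1+n; m≤n⇒m≤1+n; m<n⇒m<1+n; ⌊n/2⌋<n; ⊓-idem; ⊔-lub; module ≤-Reasoning)
open import Data.Nat.DivMod using (_%_; _/_; %-distribˡ-+; %-distribˡ-*; [m+kn]%n≡m%n; m*n%n≡0; m≡m%n+[m/n]*n; m∣n⇒o%n%m≡o%m)
open import Data.Nat.Divisibility using (_∣_; divides; m%n≡0⇒n∣m)
open import Data.Nat.Combinatorics using (_C_; nC1≡n; nCk+nC[k+1]≡[n+1]C[k+1])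
open import Data.Nat.Induction using (<-wellFounded)
open import Data.Nat.ListAction using (sum)
open import Data.Nat.ListAction.Properties using (sum-++)
open import Data.Nat.Logarithm using (⌊log₂_⌋; ⌊log₂⌋-mono-≤)
open import Data.Nat.Logarithm.Core using (⌊log2⌋)
open import Data.Nat.Tactic.RingSolver using (solve-∀)
open import Data.Product using (∃-syntax; _,_; _×_; proj₁; proj₂)
open import Data.Sum using (_⊎_; inj₁; inj₂)
open import Data.Vec using (Vec; []; _∷_; lookup)
open import Function using (_∘_; id)
open import Function.Bundles using (_⇔_; mk⇔; Equivalence)
open import Induction.WellFounded using (Acc; acc)
open import Level using (0ℓ)
open import Relation.Binary.Bundles using (Setoid)
open import Relation.Binary.PropositionalEquality
import Relation.Binary.Reasoning.Setoid
open import Relation.Nullary using (yes; no; ¬_)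
open import Relation.Unary using (Pred; Decidable)

infix 4 _≡_mod_
record _≡_mod_ (x y d : ℕ) .{{_ : NonZero d}} : Set where
  constructor ≡-mod
  field %-≡ : x % d ≡ y % d

open _≡_mod_

module _ {d : ℕ} .{{_ : NonZero d}} where

  refl-mod : ∀ {x} → x ≡ x mod d
  refl-mod = ≡-mod refl

  sym-mod : ∀ {x y} → x ≡ y mod d → y ≡ x mod d
  sym-mod (≡-mod x≡y) = ≡-mod (sym x≡y)

  trans-mod : ∀ {x y z} → x ≡ y mod d → y ≡ z mod d → x ≡ z mod d
  trans-mod (≡-mod x≡y) (≡-mod y≡z) = ≡-mod (trans x≡y y≡z)

  mod-setoid : Setoid _ _
  mod-setoid = record
    { Carrier       = ℕ
    ; _≈_           = λ x y → x ≡ y mod d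
    ; isEquivalence = record { refl = refl-mod ; sym = sym-mod ; trans = trans-mod }
    }

  ≡⇒≡-mod : ∀ {x y} → x ≡ y → x ≡ y mod d
  ≡⇒≡-mod x≡y = ≡-mod (cong (_% d) x≡y)

  +-cong-mod : ∀ {a b c e} → a ≡ b mod d → c ≡ e mod d → a + c ≡ b + e mod d
  +-cong-mod {a} {b} {c} {e} (≡-mod a≡b) (≡-mod c≡e) = ≡-mod (begin
    (a + c) % d             ≡⟨ %-distribˡ-+ a c d ⟩
    (a % d + c % d) % d     ≡⟨ cong₂ (λ x y → (x + y) % d) a≡b c≡e ⟩
    (b % d + e % d) % d     ≡⟨ %-distribˡ-+ b e d ⟨
    (b + e) % d             ∎)
    where open ≡-Reasoning

  *-cong-mod : ∀ {a b c e} → a ≡ b mod d → c ≡ e mod d → a * c ≡ b * e mod d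
  *-cong-mod {a} {b} {c} {e} (≡-mod a≡b) (≡-mod c≡e) = ≡-mod (begin
    (a * c) % d             ≡⟨ %-distribˡ-* a c d ⟩
    (a % d * (c % d)) % d   ≡⟨ cong₂ (λ x y → (x * y) % d) a≡b c≡e ⟩
    (b % d * (e % d)) % d   ≡⟨ %-distribˡ-* b e d ⟨
    (b * e) % d             ∎)
    where open ≡-Reasoning

  *-congˡ-mod : ∀ a {c e} → c ≡ e mod d → a * c ≡ a * e mod d
  *-congˡ-mod a = *-cong-mod (refl-mod {a})

  *-congʳ-mod : ∀ c {a b} → a ≡ b mod d → a * c ≡ b * c mod d
  *-congʳ-mod c a≡b = *-cong-mod a≡b (refl-mod {c})

  m+kd≡m-mod : ∀ m k → m + k * d ≡ m mod d
  m+kd≡m-mod m k = ≡-mod ([m+kn]%n≡m%n m k d)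

  sum-map-cong-mod : ∀ {A : Set} {f g : A → ℕ} → (∀ x → f x ≡ g x mod d) →
                     ∀ xs → sum (map f xs) ≡ sum (map g xs) mod d
  sum-map-cong-mod f≡g []       = ≡-mod refl
  sum-map-cong-mod f≡g (x ∷ xs) = +-cong-mod (f≡g x) (sum-map-cong-mod f≡g xs)

  m%n≡m-mod : ∀ {n} .{{_ : NonZero n}} → d ∣ n → ∀ m → m % n ≡ m mod d
  m%n≡m-mod {n} d∣n m = ≡-mod (m∣n⇒o%n%m≡o%m d n m d∣n)

module ≡-mod-Reasoning (d : ℕ) .{{_ : NonZero d}} = Relation.Binary.Reasoning.Setoid (mod-setoid {d})

suc-injective-mod : ∀ {x y d} .{{_ : NonZero d}} → suc x ≡ suc y mod d → x ≡ y mod d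
suc-injective-mod {x} {y} {suc d} 1+x≡1+y = begin
  x                 ≈⟨ m+kd≡m-mod x 1 ⟨
  x + 1 * suc d     ≡⟨ shift x d ⟩
  suc x + d         ≈⟨ +-cong-mod 1+x≡1+y (refl-mod {x = d}) ⟩
  suc y + d         ≡⟨ shift y d ⟨
  y + 1 * suc d     ≈⟨ m+kd≡m-mod y 1 ⟩
  y                 ∎
  where
  open ≡-mod-Reasoning (suc d)
  shift : ∀ x d → x + 1 * suc d ≡ suc x + d
  shift = solve-∀

mod4⇒mod2 : ∀ {x y} → x ≡ y mod 4 → x ≡ y mod 2
mod4⇒mod2 {x} {y} x≡y = ≡-mod (begin
  x % 2       ≡⟨ %-≡ (m%n≡m-mod (divides 2 refl) x) ⟨
  x % 4 % 2   ≡⟨ cong (_% 2) (%-≡ x≡y) ⟩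
  y % 4 % 2   ≡⟨ %-≡ (m%n≡m-mod (divides 2 refl) y) ⟩
  y % 2       ∎)
  where open ≡-Reasoning

≡2-mod4⇒even : ∀ {x} → x ≡ 2 mod 4 → x ≡ 0 mod 2
≡2-mod4⇒even x≡2 = ≡-mod (%-≡ (mod4⇒mod2 x≡2))

2*-cong-mod : ∀ {x y} → x ≡ y mod 2 → 2 * x ≡ 2 * y mod 4
2*-cong-mod {x} {y} (≡-mod x≡y) = begin
  2 * x                       ≡⟨ cong (2 *_) (m≡m%n+[m/n]*n x 2) ⟩
  2 * (x % 2 + x / 2 * 2)     ≡⟨ expand (x % 2) (x / 2) ⟩
  2 * (x % 2) + x / 2 * 4     ≈⟨ m+kd≡m-mod (2 * (x % 2)) (x / 2) ⟩
  2 * (x % 2)                 ≡⟨ cong (2 *_) x≡y ⟩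
  2 * (y % 2)                 ≈⟨ m+kd≡m-mod (2 * (y % 2)) (y / 2) ⟨
  2 * (y % 2) + y / 2 * 4     ≡⟨ expand (y % 2) (y / 2) ⟨
  2 * (y % 2 + y / 2 * 2)     ≡⟨ cong (2 *_) (m≡m%n+[m/n]*n y 2) ⟨
  2 * y                       ∎
  where
  open ≡-mod-Reasoning 4
  expand : ∀ r q → 2 * (r + q * 2) ≡ 2 * r + q * 4
  expand = solve-∀

2*x≡0-mod2 : ∀ x → 2 * x ≡ 0 mod 2
2*x≡0-mod2 x = ≡-mod (trans (cong (_% 2) (*-comm 2 x)) (m*n%n≡0 x 2))

even-or-odd : ∀ n → ∃[ c ] (n ≡ 2 * c ⊎ n ≡ suc (2 * c))
even-or-odd zero = 0 , inj₁ refl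
even-or-odd (suc n) with even-or-odd n
... | c , inj₁ n≡2c   = c , inj₂ (cong suc n≡2c)
... | c , inj₂ n≡1+2c = suc c , inj₁ (trans (cong suc n≡1+2c) (sym (*-suc 2 c)))

2x≤1+2y⇒x≤y : ∀ {x y} → 2 * x ≤ suc (2 * y) → x ≤ y
2x≤1+2y⇒x≤y {x} {y} 2x≤1+2y =
  s≤s⁻¹ (*-cancelˡ-< 2 x (suc y) (subst (suc (2 * x) ≤_) (sym (*-suc 2 y)) (s≤s 2x≤1+2y)))

1+2x<2y⇒x<y : ∀ {x y} → suc (2 * x) < 2 * y → x < y
1+2x<2y⇒x<y {x} {y} 2+2x≤2y = *-cancelˡ-≤ 2 (subst (_≤ 2 * y) (sym (*-suc 2 x)) 2+2x≤2y)

2x<2y⇒x<y : ∀ {x y} → 2 * x < 2 * y → x < y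
2x<2y⇒x<y {x} {y} = *-cancelˡ-< 2 x y

2*⌊n/2⌋≤n : ∀ n → 2 * ⌊ n /2⌋ ≤ n
2*⌊n/2⌋≤n zero          = z≤n
2*⌊n/2⌋≤n (suc zero)    = z≤n
2*⌊n/2⌋≤n (suc (suc n)) = subst (_≤ suc (suc n)) (sym (*-suc 2 ⌊ n /2⌋)) (s≤s (s≤s (2*⌊n/2⌋≤n n)))

n≤1+2*⌊n/2⌋ : ∀ n → n ≤ suc (2 * ⌊ n /2⌋)
n≤1+2*⌊n/2⌋ zero          = z≤n
n≤1+2*⌊n/2⌋ (suc zero)    = s≤s z≤n
n≤1+2*⌊n/2⌋ (suc (suc n)) = subst (suc (suc n) ≤_) (cong suc (sym (*-suc 2 ⌊ n /2⌋))) (s≤s (s≤s (n≤1+2*⌊n/2⌋ n)))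

⌊log2⌋-bounds : ∀ n (acc : Acc _<_ (suc n)) →
                2 ^ ⌊log2⌋ (suc n) acc ≤ suc n × suc n < 2 ^ suc (⌊log2⌋ (suc n) acc)
⌊log2⌋-bounds zero          _         = s≤s z≤n , s≤s (s≤s z≤n)
⌊log2⌋-bounds (suc n) (acc rs) with ⌊log2⌋-bounds ⌊ n /2⌋ (rs (⌊n/2⌋<n (suc n)))
... | 2^L≤1+⌊n/2⌋ , 1+⌊n/2⌋<2^[1+L] = lower , upper
  where
  L : ℕ
  L = ⌊log2⌋ (suc ⌊ n /2⌋) (rs (⌊n/2⌋<n (suc n)))
  open ≤-Reasoning
  lower : 2 * 2 ^ L ≤ suc (suc n)
  lower = begin
    2 * 2 ^ L               ≤⟨ *-monoʳ-≤ 2 2^L≤1+⌊n/2⌋ ⟩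
    2 * (1 + ⌊ n /2⌋)       ≡⟨ *-distribˡ-+ 2 1 ⌊ n /2⌋ ⟩
    2 + 2 * ⌊ n /2⌋         ≤⟨ s≤s (s≤s (2*⌊n/2⌋≤n n)) ⟩
    suc (suc n)             ∎
  upper : suc (suc n) < 2 * 2 ^ suc L
  upper = begin
    3 + n                   ≤⟨ s≤s (s≤s (s≤s (n≤1+2*⌊n/2⌋ n))) ⟩
    4 + 2 * ⌊ n /2⌋         ≡⟨ *-distribˡ-+ 2 2 ⌊ n /2⌋ ⟨
    2 * (2 + ⌊ n /2⌋)       ≤⟨ *-monoʳ-≤ 2 1+⌊n/2⌋<2^[1+L] ⟩
    2 * 2 ^ suc L           ∎

2^⌊log₂n⌋≤n<2^[1+⌊log₂n⌋] : ∀ n → 1 ≤ n → 2 ^ ⌊log₂ n ⌋ ≤ n × n < 2 ^ suc ⌊log₂ n ⌋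
2^⌊log₂n⌋≤n<2^[1+⌊log₂n⌋] (suc n) _ = ⌊log2⌋-bounds n (<-wellFounded (suc n))

-- Binomial coefficients modulo 4

pascal : ∀ n k → suc n C suc k ≡ n C k + n C suc k
pascal n k = sym (nCk+nC[k+1]≡[n+1]C[k+1] n k)

pascal₂ : ∀ n k → suc (suc n) C suc (suc k) ≡ n C k + 2 * (n C suc k) + n C suc (suc k)
pascal₂ n k = begin
  suc (suc n) C suc (suc k)
    ≡⟨ pascal (suc n) (suc k) ⟩
  suc n C suc k + suc n C suc (suc k)
    ≡⟨ cong₂ _+_ (pascal n k) (pascal n (suc k)) ⟩
  (n C k + n C suc k) + (n C suc k + n C suc (suc k))
    ≡⟨ regroup (n C k) (n C suc k) (n C suc (suc k)) ⟩
  n C k + 2 * (n C suc k) + n C suc (suc k) ∎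
  where
  open ≡-Reasoning
  regroup : ∀ x y z → (x + y) + (y + z) ≡ x + 2 * y + z
  regroup = solve-∀

a*[a-1]Cb-pascal : ∀ a b → a * (pred a C b) + a * (pred a C suc b) ≡ a * (a C suc b)
a*[a-1]Cb-pascal zero    b = refl
a*[a-1]Cb-pascal (suc a) b = trans (sym (*-distribˡ-+ (suc a) (a C b) (a C suc b))) (cong (suc a *_) (sym (pascal a b)))

mutual
  [2a]C[2b]≡aCb-mod4 : ∀ a b → (2 * a) C (2 * b) ≡ a C b mod 4
  [2a]C[2b]≡aCb-mod4 zero    zero    = ≡-mod refl
  [2a]C[2b]≡aCb-mod4 zero    (suc b) = ≡-mod refl
  [2a]C[2b]≡aCb-mod4 (suc a) zero    = ≡-mod refl
  [2a]C[2b]≡aCb-mod4 (suc a) (suc b) = begin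
    (2 * suc a) C (2 * suc b)
      ≡⟨ cong₂ _C_ (*-suc 2 a) (*-suc 2 b) ⟩
    suc (suc A) C suc (suc B)
      ≡⟨ pascal₂ A B ⟩
    A C B + 2 * (A C suc B) + A C suc (suc B)
      ≡⟨ cong (λ x → A C B + 2 * (A C suc B) + A C x) (*-suc 2 b) ⟨
    A C B + 2 * (A C suc B) + A C (2 * suc b)
      ≈⟨ +-cong-mod (+-cong-mod ([2a]C[2b]≡aCb-mod4 a b) (2*-cong-mod A[1+B]-even))
                    ([2a]C[2b]≡aCb-mod4 a (suc b)) ⟩
    a C b + 2 * 0 + a C suc b
      ≡⟨ cong (_+ a C suc b) (+-identityʳ (a C b)) ⟩
    a C b + a C suc b
      ≡⟨ pascal a b ⟨
    suc a C suc b ∎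
    where
    open ≡-mod-Reasoning 4
    A = 2 * a
    B = 2 * b
    A[1+B]-even : A C suc B ≡ 0 mod 2
    A[1+B]-even = trans-mod (mod4⇒mod2 ([2a]C[1+2b]≡2a[a-1]Cb-mod4 a b)) (2*x≡0-mod2 (a * (pred a C b)))

  [2a]C[1+2b]≡2a[a-1]Cb-mod4 : ∀ a b → (2 * a) C suc (2 * b) ≡ 2 * (a * (pred a C b)) mod 4
  [2a]C[1+2b]≡2a[a-1]Cb-mod4 zero    b    = ≡-mod refl
  [2a]C[1+2b]≡2a[a-1]Cb-mod4 (suc a) zero =
    ≡⇒≡-mod (trans (nC1≡n (2 * suc a)) (cong (2 *_) (sym (*-identityʳ (suc a)))))
  [2a]C[1+2b]≡2a[a-1]Cb-mod4 (suc a) (suc b) = begin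
    (2 * suc a) C suc (2 * suc b)
      ≡⟨ cong₂ (λ x y → x C suc y) (*-suc 2 a) (*-suc 2 b) ⟩
    suc (suc A) C suc (suc (suc B))
      ≡⟨ pascal₂ A (suc B) ⟩
    A C suc B + 2 * (A C suc (suc B)) + A C suc (suc (suc B))
      ≡⟨ cong (λ x → A C suc B + 2 * (A C x) + A C suc x) (*-suc 2 b) ⟨
    A C suc B + 2 * (A C (2 * suc b)) + A C suc (2 * suc b)
      ≈⟨ +-cong-mod (+-cong-mod ([2a]C[1+2b]≡2a[a-1]Cb-mod4 a b)
                                (2*-cong-mod (mod4⇒mod2 ([2a]C[2b]≡aCb-mod4 a (suc b)))))
                    ([2a]C[1+2b]≡2a[a-1]Cb-mod4 a (suc b)) ⟩
    2 * X + 2 * Y + 2 * Z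
      ≡⟨ regroup X Y Z ⟩
    2 * (X + Z) + 2 * Y
      ≡⟨ cong (λ s → 2 * s + 2 * Y) (a*[a-1]Cb-pascal a b) ⟩
    2 * (a * Y) + 2 * Y
      ≡⟨ factor a Y ⟩
    2 * (suc a * Y) ∎
    where
    open ≡-mod-Reasoning 4
    A = 2 * a
    B = 2 * b
    X = a * (pred a C b)
    Y = a C suc b
    Z = a * (pred a C suc b)
    regroup : ∀ x y z → 2 * x + 2 * y + 2 * z ≡ 2 * (x + z) + 2 * y
    regroup = solve-∀
    factor : ∀ a y → 2 * (a * y) + 2 * y ≡ 2 * (suc a * y)
    factor = solve-∀

sumTo-cong : ∀ h {f g : ℕ → ℕ} → (∀ i → f i ≡ g i) → sumTo h f ≡ sumTo h g
sumTo-cong zero    f≡g = f≡g 0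
sumTo-cong (suc h) f≡g = cong₂ _+_ (f≡g 0) (sumTo-cong h (f≡g ∘ suc))

sumTo-+ : ∀ h (f g : ℕ → ℕ) → sumTo h (λ i → f i + g i) ≡ sumTo h f + sumTo h g
sumTo-+ zero    f g = refl
sumTo-+ (suc h) f g = begin
  f 0 + g 0 + sumTo h (λ i → f (suc i) + g (suc i))
    ≡⟨ cong (f 0 + g 0 +_) (sumTo-+ h (f ∘ suc) (g ∘ suc)) ⟩
  f 0 + g 0 + (sumTo h (f ∘ suc) + sumTo h (g ∘ suc))
    ≡⟨ +-interchange (f 0) (g 0) (sumTo h (f ∘ suc)) (sumTo h (g ∘ suc)) ⟩
  f 0 + sumTo h (f ∘ suc) + (g 0 + sumTo h (g ∘ suc)) ∎
  where
  open ≡-Reasoning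
  +-interchange : ∀ a b c d → a + b + (c + d) ≡ a + c + (b + d)
  +-interchange = solve-∀

sumTo-last : ∀ h (f : ℕ → ℕ) → sumTo (suc h) f ≡ sumTo h f + f (suc h)
sumTo-last zero    f = refl
sumTo-last (suc h) f = trans (cong (f 0 +_) (sumTo-last h (f ∘ suc))) (sym (+-assoc (f 0) _ _))

binomSum-zeroˡ : ∀ h → binomSum 0 h ≡ 1
binomSum-zeroˡ zero    = refl
binomSum-zeroˡ (suc h) = cong suc (sumTo-zero h)
  where
  sumTo-zero : ∀ h → sumTo h (λ _ → 0) ≡ 0
  sumTo-zero zero    = refl
  sumTo-zero (suc h) = sumTo-zero h

binomSum-pascal : ∀ m h → binomSum (suc m) (suc h) ≡ binomSum m h + binomSum m (suc h)
binomSum-pascal m h = begin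
  1 + sumTo h (λ i → suc m C suc i)
    ≡⟨ cong suc (sumTo-cong h (pascal m)) ⟩
  1 + sumTo h (λ i → m C i + m C suc i)
    ≡⟨ cong suc (sumTo-+ h (m C_) (λ i → m C suc i)) ⟩
  1 + (binomSum m h + sumTo h (λ i → m C suc i))
    ≡⟨ +-suc (binomSum m h) _ ⟨
  binomSum m h + (1 + sumTo h (λ i → m C suc i)) ∎
  where open ≡-Reasoning

binomSum-double : ∀ m h → binomSum (suc m) (suc h) ≡ 2 * binomSum m h + m C suc h
binomSum-double m h = begin
  binomSum (suc m) (suc h)                       ≡⟨ binomSum-pascal m h ⟩
  binomSum m h + binomSum m (suc h)              ≡⟨ cong (binomSum m h +_) (sumTo-last h (m C_)) ⟩
  binomSum m h + (binomSum m h + m C suc h)      ≡⟨ regroup (binomSum m h) (m C suc h) ⟩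
  2 * binomSum m h + m C suc h                   ∎
  where
  open ≡-Reasoning
  regroup : ∀ x y → x + (x + y) ≡ 2 * x + y
  regroup = solve-∀

binomSum[1+m]j≡mCj-mod2 : ∀ m j → binomSum (suc m) j ≡ m C j mod 2
binomSum[1+m]j≡mCj-mod2 m zero    = refl-mod
binomSum[1+m]j≡mCj-mod2 m (suc j) = begin
  binomSum (suc m) (suc j)          ≡⟨ binomSum-double m j ⟩
  2 * binomSum m j + m C suc j      ≡⟨ +-comm (2 * binomSum m j) _ ⟩
  m C suc j + 2 * binomSum m j      ≡⟨ cong (m C suc j +_) (*-comm 2 (binomSum m j)) ⟩
  m C suc j + binomSum m j * 2      ≈⟨ m+kd≡m-mod (m C suc j) (binomSum m j) ⟩
  m C suc j                         ∎
  where open ≡-mod-Reasoning 2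

-- The binomial coefficients of 2^t w − 1 and 2^t w − 2

≡3-mod4⇒positive : ∀ {w} → w ≡ 3 mod 4 → 0 < w
≡3-mod4⇒positive {suc w} _ = z<s

module _ {w : ℕ} (w≡3 : w ≡ 3 mod 4) where

  2^t*w>0 : ∀ t → 0 < 2 ^ t * w
  2^t*w>0 t = >-nonZero⁻¹ (2 ^ t * w) {{m*n≢0 (2 ^ t) w}}
    where
    instance
      _ = m^n≢0 2 t
      _ = >-nonZero (≡3-mod4⇒positive w≡3)

  ∃[1+N]≡2^t*w : ∀ t → ∃[ N ] suc N ≡ 2 ^ t * w
  ∃[1+N]≡2^t*w t with 2 ^ t * w | 2^t*w>0 t
  ... | suc N | _ = N , refl

  [1+N]≡2^[1+t]*w : ∀ t {N N′} → suc N′ ≡ 2 ^ t * w → suc N ≡ 2 ^ suc t * w → N ≡ suc (2 * N′)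
  [1+N]≡2^[1+t]*w t {N} {N′} 1+N′≡2^t*w 1+N≡2^[1+t]*w = suc-injective (begin
    suc N                  ≡⟨ 1+N≡2^[1+t]*w ⟩
    2 * 2 ^ t * w          ≡⟨ *-assoc 2 (2 ^ t) w ⟩
    2 * (2 ^ t * w)        ≡⟨ cong (2 *_) 1+N′≡2^t*w ⟨
    2 * suc N′             ≡⟨ *-suc 2 N′ ⟩
    suc (suc (2 * N′))     ∎)
    where open ≡-Reasoning

  [1+N]≡w⇒N≡2-mod4 : ∀ {N} → suc N ≡ 2 ^ 0 * w → N ≡ 2 mod 4
  [1+N]≡w⇒N≡2-mod4 1+N≡w = suc-injective-mod
    (trans-mod (≡⇒≡-mod (trans 1+N≡w (+-identityʳ w))) w≡3)

  -- N stands for 2^t w − 1 (in the last lemma for 2^{t+1} w − 2) and is given through suc N, avoiding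
  -- truncated subtraction. Halving h takes the first lemma from t + 1 to t; the parity lemmas make the
  -- error term 2 N C(N − 1, c) of the mod-4 congruences vanish.
  mutual
    [2^t*w-1]Ch≡2-mod4 : ∀ t {N} → suc N ≡ 2 ^ t * w → ∀ {h} → 2 ^ t ≤ h → h < 2 ^ suc t →
                         N C h ≡ 2 mod 4
    [2^t*w-1]Ch≡2-mod4 zero {N} 1+N≡w {suc zero} _ _ =
      trans-mod (≡⇒≡-mod (nC1≡n N)) ([1+N]≡w⇒N≡2-mod4 1+N≡w)
    [2^t*w-1]Ch≡2-mod4 zero _ {suc (suc h)} _ (s≤s (s≤s ()))
    [2^t*w-1]Ch≡2-mod4 (suc t) 1+N≡2^[1+t]*w {h} 2^[1+t]≤h h<2^[2+t]
      with N′ , 1+N′≡2^t*w ← ∃[1+N]≡2^t*w t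
      with refl ← [1+N]≡2^[1+t]*w t 1+N′≡2^t*w 1+N≡2^[1+t]*w
      with even-or-odd h
    ... | c , inj₂ refl = begin
      suc (2 * N′) C suc (2 * c)
        ≡⟨ pascal (2 * N′) (2 * c) ⟩
      (2 * N′) C (2 * c) + (2 * N′) C suc (2 * c)
        ≈⟨ +-cong-mod ([2a]C[2b]≡aCb-mod4 N′ c) ([2a]C[1+2b]≡2a[a-1]Cb-mod4 N′ c) ⟩
      N′ C c + 2 * (N′ * (pred N′ C c))
        ≈⟨ +-cong-mod ([2^t*w-1]Ch≡2-mod4 t 1+N′≡2^t*w 2^t≤c c<2^[1+t])
                      (2*-cong-mod ([2^t*w-1]*[2^t*w-2]Cc-even t 1+N′≡2^t*w 2^t≤1+c c<2^[1+t])) ⟩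
      2 + 2 * 0 ∎
      where
      open ≡-mod-Reasoning 4
      2^t≤c : 2 ^ t ≤ c
      2^t≤c = 2x≤1+2y⇒x≤y 2^[1+t]≤h
      c<2^[1+t] : c < 2 ^ suc t
      c<2^[1+t] = 1+2x<2y⇒x<y h<2^[2+t]
      2^t≤1+c : 2 ^ t ≤ suc c
      2^t≤1+c = m≤n⇒m≤1+n 2^t≤c
    ... | zero , inj₁ refl = ⊥-elim (<⇒≱ (m^n>0 2 (suc t)) 2^[1+t]≤h)
    ... | suc c , inj₁ refl = begin
      suc (2 * N′) C (2 * suc c)
        ≡⟨ cong (suc (2 * N′) C_) (*-suc 2 c) ⟩
      suc (2 * N′) C suc (suc (2 * c))
        ≡⟨ pascal (2 * N′) (suc (2 * c)) ⟩
      (2 * N′) C suc (2 * c) + (2 * N′) C suc (suc (2 * c))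
        ≡⟨ cong (λ x → (2 * N′) C suc (2 * c) + (2 * N′) C x) (*-suc 2 c) ⟨
      (2 * N′) C suc (2 * c) + (2 * N′) C (2 * suc c)
        ≈⟨ +-cong-mod ([2a]C[1+2b]≡2a[a-1]Cb-mod4 N′ c) ([2a]C[2b]≡aCb-mod4 N′ (suc c)) ⟩
      2 * (N′ * (pred N′ C c)) + N′ C suc c
        ≈⟨ +-cong-mod (2*-cong-mod ([2^t*w-1]*[2^t*w-2]Cc-even t 1+N′≡2^t*w 2^t≤1+c c<2^[1+t]))
                      ([2^t*w-1]Ch≡2-mod4 t 1+N′≡2^t*w 2^t≤1+c 1+c<2^[1+t]) ⟩
      2 * 0 + 2 ∎
      where
      open ≡-mod-Reasoning 4
      2^t≤1+c : 2 ^ t ≤ suc c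
      2^t≤1+c = *-cancelˡ-≤ 2 2^[1+t]≤h
      1+c<2^[1+t] : suc c < 2 ^ suc t
      1+c<2^[1+t] = 2x<2y⇒x<y h<2^[2+t]
      c<2^[1+t] : c < 2 ^ suc t
      c<2^[1+t] = <-trans (n<1+n c) 1+c<2^[1+t]

    [2^t*w-1]*[2^t*w-2]Cc-even : ∀ t {N} → suc N ≡ 2 ^ t * w → ∀ {c} → 2 ^ t ≤ suc c → c < 2 ^ suc t →
                                 N * (pred N C c) ≡ 0 mod 2
    [2^t*w-1]*[2^t*w-2]Cc-even zero {N} 1+N≡w {c} _ _ =
      *-congʳ-mod (pred N C c) (≡2-mod4⇒even ([1+N]≡w⇒N≡2-mod4 1+N≡w))
    [2^t*w-1]*[2^t*w-2]Cc-even (suc t) 1+N≡2^[1+t]*w {c} 2^[1+t]≤1+c c<2^[2+t]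
      with N′ , 1+N′≡2^t*w ← ∃[1+N]≡2^t*w t
      with refl ← [1+N]≡2^[1+t]*w t 1+N′≡2^t*w 1+N≡2^[1+t]*w
      = trans-mod
        (*-congˡ-mod (suc (2 * N′)) ([2^t*w-2]Cj-even t 1+N≡2^[1+t]*w 2^[1+t]≤1+c c<2^[2+t]))
        (≡⇒≡-mod (*-zeroʳ (suc (2 * N′))))

    [2^t*w-2]Cj-even : ∀ t {N} → suc (suc N) ≡ 2 ^ suc t * w → ∀ {j} → 2 ^ suc t ≤ suc j → j < 2 ^ suc (suc t) →
                       N C j ≡ 0 mod 2
    [2^t*w-2]Cj-even t 2+N≡2^[1+t]*w {j} 2^[1+t]≤1+j j<2^[2+t]
      with N′ , 1+N′≡2^t*w ← ∃[1+N]≡2^t*w t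
      with refl ← suc-injective ([1+N]≡2^[1+t]*w t 1+N′≡2^t*w 2+N≡2^[1+t]*w)
      with even-or-odd j
    ... | c , inj₂ refl = trans-mod
      (mod4⇒mod2 ([2a]C[1+2b]≡2a[a-1]Cb-mod4 N′ c)) (2*x≡0-mod2 (N′ * (pred N′ C c)))
    ... | c , inj₁ refl = ≡2-mod4⇒even (trans-mod ([2a]C[2b]≡aCb-mod4 N′ c)
      ([2^t*w-1]Ch≡2-mod4 t 1+N′≡2^t*w (2x≤1+2y⇒x≤y {2 ^ t} 2^[1+t]≤1+j) (2x<2y⇒x<y {c} j<2^[2+t])))

  binomSum-2^[1+t]*w : ∀ t {j} → 2 ^ suc t ≤ suc j → suc j < 2 ^ suc (suc t) →
                       let m = 2 ^ suc t * w in binomSum (pred m) j ≡ 0 mod 2 × binomSum m (suc j) ≡ 2 mod 4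
  binomSum-2^[1+t]*w t {j} 2^[1+t]≤1+j 1+j<2^[2+t]
    with N′ , 1+N′≡2^t*w ← ∃[1+N]≡2^t*w t
    with N , 1+N≡2^[1+t]*w ← ∃[1+N]≡2^t*w (suc t)
    with refl ← [1+N]≡2^[1+t]*w t 1+N′≡2^t*w 1+N≡2^[1+t]*w
    rewrite sym 1+N≡2^[1+t]*w = binomSum-even , binomSum≡2
    where
    M : ℕ
    M = suc (2 * N′)
    binomSum-even : binomSum M j ≡ 0 mod 2
    binomSum-even = trans-mod (binomSum[1+m]j≡mCj-mod2 (2 * N′) j)
      ([2^t*w-2]Cj-even t 1+N≡2^[1+t]*w 2^[1+t]≤1+j (<-trans (n<1+n j) 1+j<2^[2+t]))
    binomSum≡2 : binomSum (suc M) (suc j) ≡ 2 mod 4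
    binomSum≡2 = begin
      binomSum (suc M) (suc j)           ≡⟨ binomSum-double M j ⟩
      2 * binomSum M j + M C suc j       ≈⟨ +-cong-mod (2*-cong-mod binomSum-even)
                                              ([2^t*w-1]Ch≡2-mod4 (suc t) 1+N≡2^[1+t]*w 2^[1+t]≤1+j 1+j<2^[2+t]) ⟩
      2 * 0 + 2                          ∎
      where open ≡-mod-Reasoning 4

  binomSum-2^⌊log₂h⌋*w : ∀ h → 2 ≤ h → let m = 2 ^ ⌊log₂ h ⌋ * w in
                         binomSum (pred m) (pred h) ≡ 0 mod 2 × binomSum m h ≡ 2 mod 4
  binomSum-2^⌊log₂h⌋*w (suc j) 2≤h
    with ⌊log₂ suc j ⌋ | ⌊log₂⌋-mono-≤ 2≤h | 2^⌊log₂n⌋≤n<2^[1+⌊log₂n⌋] (suc j) (s≤s z≤n)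
  ... | suc t | _ | 2^[1+t]≤1+j , 1+j<2^[2+t] = binomSum-2^[1+t]*w t 2^[1+t]≤1+j 1+j<2^[2+t]

choicesUpTo : (m h : ℕ) → List (Vec Bool m)
choicesUpTo zero    h       = [] ∷ []
choicesUpTo (suc m) zero    = map (false ∷_) (choicesUpTo m zero)
choicesUpTo (suc m) (suc h) = map (true ∷_) (choicesUpTo m h) ++ map (false ∷_) (choicesUpTo m (suc h))

filter-map : ∀ {A B : Set} {P : Pred B 0ℓ} {Q : Pred A 0ℓ} (P? : Decidable P) (Q? : Decidable Q)
             (f : A → B) → (∀ {x} → P (f x) ⇔ Q x) → ∀ xs → filter P? (map f xs) ≡ map f (filter Q? xs)
filter-map P? Q? f Pf⇔Q []       = refl
filter-map P? Q? f Pf⇔Q (x ∷ xs) with P? (f x) | Q? x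
... | yes _   | yes _  = cong (f x ∷_) (filter-map P? Q? f Pf⇔Q xs)
... | no _    | no _   = filter-map P? Q? f Pf⇔Q xs
... | yes Pfx | no ¬Qx = ⊥-elim (¬Qx (Equivalence.to Pf⇔Q Pfx))
... | no ¬Pfx | yes Qx = ⊥-elim (¬Pfx (Equivalence.from Pf⇔Q Qx))

weight≤? : ∀ {m} h → Decidable (λ (bs : Vec Bool m) → weight bs ≤ h)
weight≤? h bs = weight bs ≤? h

filter-weight≤-allChoices : ∀ m h → filter (weight≤? h) (allChoices m) ≡ choicesUpTo m h
filter-weight≤-allChoices zero    h       = refl
filter-weight≤-allChoices (suc m) zero    = begin
  filter (weight≤? 0) (map (true ∷_) (allChoices m) ++ map (false ∷_) (allChoices m))
    ≡⟨ filter-++ (weight≤? 0) (map (true ∷_) (allChoices m)) _ ⟩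
  filter (weight≤? 0) (map (true ∷_) (allChoices m)) ++ filter (weight≤? 0) (map (false ∷_) (allChoices m))
    ≡⟨ cong₂ _++_ (filter-none (weight≤? 0) (All.map⁺ (All.universal (λ _ ()) (allChoices m))))
                  (filter-map (weight≤? 0) (weight≤? 0) (false ∷_) (mk⇔ id id) (allChoices m)) ⟩
  map (false ∷_) (filter (weight≤? 0) (allChoices m))
    ≡⟨ cong (map (false ∷_)) (filter-weight≤-allChoices m zero) ⟩
  choicesUpTo (suc m) zero ∎
  where open ≡-Reasoning
filter-weight≤-allChoices (suc m) (suc h) = begin
  filter (weight≤? (suc h)) (map (true ∷_) (allChoices m) ++ map (false ∷_) (allChoices m))
    ≡⟨ filter-++ (weight≤? (suc h)) (map (true ∷_) (allChoices m)) _ ⟩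
  filter (weight≤? (suc h)) (map (true ∷_) (allChoices m)) ++ filter (weight≤? (suc h)) (map (false ∷_) (allChoices m))
    ≡⟨ cong₂ _++_ (filter-map (weight≤? (suc h)) (weight≤? h) (true ∷_) (mk⇔ s≤s⁻¹ s≤s) (allChoices m))
                  (filter-map (weight≤? (suc h)) (weight≤? (suc h)) (false ∷_) (mk⇔ id id) (allChoices m)) ⟩
  map (true ∷_) (filter (weight≤? h) (allChoices m)) ++ map (false ∷_) (filter (weight≤? (suc h)) (allChoices m))
    ≡⟨ cong₂ (λ xs ys → map (true ∷_) xs ++ map (false ∷_) ys)
             (filter-weight≤-allChoices m h) (filter-weight≤-allChoices m (suc h)) ⟩
  choicesUpTo (suc m) (suc h) ∎
  where open ≡-Reasoning

length-choicesUpTo : ∀ m h → length (choicesUpTo m h) ≡ binomSum m h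
length-choicesUpTo zero    h       = sym (binomSum-zeroˡ h)
length-choicesUpTo (suc m) zero    = trans (length-map (false ∷_) (choicesUpTo m zero)) (length-choicesUpTo m zero)
length-choicesUpTo (suc m) (suc h) = begin
  length (map (true ∷_) (choicesUpTo m h) ++ map (false ∷_) (choicesUpTo m (suc h)))
    ≡⟨ length-++ (map (true ∷_) (choicesUpTo m h)) ⟩
  length (map (true ∷_) (choicesUpTo m h)) + length (map (false ∷_) (choicesUpTo m (suc h)))
    ≡⟨ cong₂ _+_ (length-map (true ∷_) (choicesUpTo m h)) (length-map (false ∷_) (choicesUpTo m (suc h))) ⟩
  length (choicesUpTo m h) + length (choicesUpTo m (suc h))
    ≡⟨ cong₂ _+_ (length-choicesUpTo m h) (length-choicesUpTo m (suc h)) ⟩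
  binomSum m h + binomSum m (suc h)
    ≡⟨ binomSum-pascal m h ⟨
  binomSum (suc m) (suc h) ∎
  where open ≡-Reasoning

sum-map-k+ : ∀ {A : Set} k (f : A → ℕ) xs → sum (map (λ x → k + f x) xs) ≡ length xs * k + sum (map f xs)
sum-map-k+ k f []       = refl
sum-map-k+ k f (x ∷ xs) = begin
  k + f x + sum (map (λ x → k + f x) xs)       ≡⟨ cong (k + f x +_) (sum-map-k+ k f xs) ⟩
  k + f x + (length xs * k + sum (map f xs))   ≡⟨ regroup k (f x) (length xs * k) (sum (map f xs)) ⟩
  k + length xs * k + (f x + sum (map f xs))   ∎
  where
  open ≡-Reasoning
  regroup : ∀ a b c d → a + b + (c + d) ≡ a + c + (b + d)
  regroup = solve-∀

module _ {n : ℕ} where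

  total : ∀ {m} → (Fin m → Fin n) → ℕ
  total {zero}  a = 0
  total {suc m} a = toℕ (a zero) + total (a ∘ suc)

  sumOfSums : ∀ m h → (Fin m → Fin n) → ℕ
  sumOfSums m h a = sum (map (λ c → lsum c a) (choicesUpTo m h))

  sumOfSums-zero : ∀ m (a : Fin m → Fin n) → sumOfSums m 0 a ≡ 0
  sumOfSums-zero zero    a = refl
  sumOfSums-zero (suc m) a =
    trans (cong sum (sym (map-∘ (choicesUpTo m 0)))) (sumOfSums-zero m (a ∘ suc))

  sumOfSums-split : ∀ m h (a : Fin (suc m) → Fin n) →
    sumOfSums (suc m) (suc h) a ≡
    binomSum m h * toℕ (a zero) + (sumOfSums m h (a ∘ suc) + sumOfSums m (suc h) (a ∘ suc))
  sumOfSums-split m h a = begin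
    sum (map (λ c → lsum c a) (map (true ∷_) (choicesUpTo m h) ++ map (false ∷_) (choicesUpTo m (suc h))))
      ≡⟨ cong sum (map-++ (λ c → lsum c a) (map (true ∷_) (choicesUpTo m h)) _) ⟩
    sum (map (λ c → lsum c a) (map (true ∷_) (choicesUpTo m h)) ++ map (λ c → lsum c a) (map (false ∷_) (choicesUpTo m (suc h))))
      ≡⟨ sum-++ (map (λ c → lsum c a) (map (true ∷_) (choicesUpTo m h))) _ ⟩
    sum (map (λ c → lsum c a) (map (true ∷_) (choicesUpTo m h))) + sum (map (λ c → lsum c a) (map (false ∷_) (choicesUpTo m (suc h))))
      ≡⟨ cong₂ _+_ (cong sum (sym (map-∘ (choicesUpTo m h)))) (cong sum (sym (map-∘ (choicesUpTo m (suc h))))) ⟩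
    sum (map (λ c → toℕ (a zero) + lsum c (a ∘ suc)) (choicesUpTo m h)) + sumOfSums m (suc h) (a ∘ suc)
      ≡⟨ cong (_+ sumOfSums m (suc h) (a ∘ suc)) (sum-map-k+ (toℕ (a zero)) (λ c → lsum c (a ∘ suc)) (choicesUpTo m h)) ⟩
    length (choicesUpTo m h) * toℕ (a zero) + sumOfSums m h (a ∘ suc) + sumOfSums m (suc h) (a ∘ suc)
      ≡⟨ +-assoc (length (choicesUpTo m h) * toℕ (a zero)) _ _ ⟩
    length (choicesUpTo m h) * toℕ (a zero) + (sumOfSums m h (a ∘ suc) + sumOfSums m (suc h) (a ∘ suc))
      ≡⟨ cong (λ l → l * toℕ (a zero) + (sumOfSums m h (a ∘ suc) + sumOfSums m (suc h) (a ∘ suc))) (length-choicesUpTo m h) ⟩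
    binomSum m h * toℕ (a zero) + (sumOfSums m h (a ∘ suc) + sumOfSums m (suc h) (a ∘ suc)) ∎
    where open ≡-Reasoning

  mutual
    -- A fixed index lies in binomSum (m − 1) (h − 1) choices of weight ≤ h and in binomSum (m − 1) h of
    -- weight ≤ h + 1; by Pascal's rule these add up to binomSum m h.
    sumOfSums-pair : ∀ m h (a : Fin m → Fin n) →
                     sumOfSums m h a + sumOfSums m (suc h) a ≡ binomSum m h * total a
    sumOfSums-pair zero    h       a = sym (*-zeroʳ (binomSum 0 h))
    sumOfSums-pair (suc m) zero    a = cong₂ _+_ (sumOfSums-zero (suc m) a) (sumOfSums-suc m zero a)
    sumOfSums-pair (suc m) (suc h) a = begin
      sumOfSums (suc m) (suc h) a + sumOfSums (suc m) (suc (suc h)) a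
        ≡⟨ cong₂ _+_ (sumOfSums-suc m h a) (sumOfSums-suc m (suc h) a) ⟩
      binomSum m h * total a + binomSum m (suc h) * total a
        ≡⟨ *-distribʳ-+ (total a) (binomSum m h) _ ⟨
      (binomSum m h + binomSum m (suc h)) * total a
        ≡⟨ cong (_* total a) (binomSum-pascal m h) ⟨
      binomSum (suc m) (suc h) * total a ∎
      where open ≡-Reasoning

    sumOfSums-suc : ∀ m h (a : Fin (suc m) → Fin n) → sumOfSums (suc m) (suc h) a ≡ binomSum m h * total a
    sumOfSums-suc m h a = begin
      sumOfSums (suc m) (suc h) a
        ≡⟨ sumOfSums-split m h a ⟩
      binomSum m h * toℕ (a zero) + (sumOfSums m h (a ∘ suc) + sumOfSums m (suc h) (a ∘ suc))
        ≡⟨ cong (binomSum m h * toℕ (a zero) +_) (sumOfSums-pair m h (a ∘ suc)) ⟩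
      binomSum m h * toℕ (a zero) + binomSum m h * total (a ∘ suc)
        ≡⟨ *-distribˡ-+ (binomSum m h) (toℕ (a zero)) _ ⟨
      binomSum m h * total a ∎
      where open ≡-Reasoning

triangle : ℕ → ℕ
triangle zero    = 0
triangle (suc n) = n + triangle n

sum-covering : ∀ n (xs : List ℕ) → length xs ≡ n → (∀ x → x < n → x ∈ xs) → sum xs ≡ triangle n
sum-covering zero    []       _   _     = refl
sum-covering (suc n) xs       len cover with ∈-∃++ (cover n (n<1+n n))
... | ys , zs , refl = begin
  sum (ys ++ n ∷ zs)        ≡⟨ sum-++ ys (n ∷ zs) ⟩
  sum ys + (n + sum zs)     ≡⟨ regroup (sum ys) n (sum zs) ⟩
  n + (sum ys + sum zs)     ≡⟨ cong (n +_) (sum-++ ys zs) ⟨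
  n + sum (ys ++ zs)        ≡⟨ cong (n +_) (sum-covering n (ys ++ zs) len′ cover′) ⟩
  n + triangle n            ∎
  where
  open ≡-Reasoning
  regroup : ∀ a b c → a + (b + c) ≡ b + (a + c)
  regroup = solve-∀
  len′ : length (ys ++ zs) ≡ n
  len′ = suc-injective (begin
    suc (length (ys ++ zs))     ≡⟨ cong suc (length-++ ys) ⟩
    suc (length ys + length zs) ≡⟨ +-suc (length ys) (length zs) ⟨
    length ys + length (n ∷ zs) ≡⟨ length-++ ys ⟨
    length (ys ++ n ∷ zs)       ≡⟨ len ⟩
    suc n                       ∎)
  cover′ : ∀ x → x < n → x ∈ ys ++ zs
  cover′ x x<n with ++⁻ ys (cover x (m<n⇒m<1+n x<n))
  ... | inj₁ x∈ys            = ++⁺ˡ x∈ys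
  ... | inj₂ (here refl)     = ⊥-elim (<-irrefl refl x<n)
  ... | inj₂ (there x∈zs)    = ++⁺ʳ ys x∈zs

triangle-[2+4q]-odd : ∀ q → triangle (2 + q * 4) ≡ 1 mod 2
triangle-[2+4q]-odd zero    = refl-mod
triangle-[2+4q]-odd (suc q) = begin
  triangle (6 + r)                        ≡⟨ unfold r (triangle (2 + r)) ⟩
  triangle (2 + r) + (7 + 2 * r) * 2      ≈⟨ m+kd≡m-mod (triangle (2 + r)) (7 + 2 * r) ⟩
  triangle (2 + r)                        ≈⟨ triangle-[2+4q]-odd q ⟩
  1                                       ∎
  where
  open ≡-mod-Reasoning 2
  r : ℕ
  r = q * 4
  unfold : ∀ r t → 5 + r + (4 + r + (3 + r + (2 + r + t))) ≡ t + (7 + 2 * r) * 2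
  unfold = solve-∀

triangle-odd : ∀ n → n ≡ 2 mod 4 → triangle n ≡ 1 mod 2
triangle-odd n (≡-mod n%4≡2) =
  subst (λ x → triangle x ≡ 1 mod 2) (sym n≡2+[n/4]*4) (triangle-[2+4q]-odd (n / 4))
  where
  n≡2+[n/4]*4 : n ≡ 2 + n / 4 * 4
  n≡2+[n/4]*4 = trans (m≡m%n+[m/n]*n n 4) (cong (_+ n / 4 * 4) n%4≡2)

-- The restricted sumset misses a residue

restrictedSums≡ : ∀ {m} n .{{_ : NonZero n}} h (a : Fin m → Fin n) →
                  restrictedSums n h a ≡ map (λ c → lsum c a % n) (choicesUpTo m h)
restrictedSums≡ {m} n h a = cong (map (λ c → lsum c a % n)) (filter-weight≤-allChoices m h)

restrictedSums-incomplete : ∀ {n} .{{_ : NonZero n}} M j → n ≡ 2 mod 4 →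
  binomSum (suc M) (suc j) ≡ n → binomSum M j ≡ 0 mod 2 → (a : Fin (suc M) → Fin n) →
  ¬ (∀ x → x < n → x ∈ restrictedSums n (suc j) a)
restrictedSums-incomplete {n} M j n≡2 |choices|≡n binomSum-even a cover = 1≢0 (%-≡ 1≡0-mod2)
  where
  sums : List ℕ
  sums = restrictedSums n (suc j) a
  choices : List (Vec Bool (suc M))
  choices = choicesUpTo (suc M) (suc j)
  |sums|≡n : length sums ≡ n
  |sums|≡n = begin
    length sums                                      ≡⟨ cong length (restrictedSums≡ n (suc j) a) ⟩
    length (map (λ c → lsum c a % n) choices)        ≡⟨ length-map _ choices ⟩
    length choices                                   ≡⟨ length-choicesUpTo (suc M) (suc j) ⟩
    binomSum (suc M) (suc j)                         ≡⟨ |choices|≡n ⟩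
    n                                                ∎
    where open ≡-Reasoning
  2∣n : 2 ∣ n
  2∣n = m%n≡0⇒n∣m n 2 (%-≡ (≡2-mod4⇒even n≡2))
  1≡0-mod2 : 1 ≡ 0 mod 2
  1≡0-mod2 = begin
    1                                                ≈⟨ triangle-odd n n≡2 ⟨
    triangle n                                       ≡⟨ sum-covering n sums |sums|≡n cover ⟨
    sum sums                                         ≡⟨ cong sum (restrictedSums≡ n (suc j) a) ⟩
    sum (map (λ c → lsum c a % n) choices)           ≈⟨ sum-map-cong-mod (λ c → m%n≡m-mod 2∣n (lsum c a)) choices ⟩
    sumOfSums (suc M) (suc j) a                      ≡⟨ sumOfSums-suc M j a ⟩
    binomSum M j * total a                           ≈⟨ *-congʳ-mod (total a) binomSum-even ⟩
    0                                                ∎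
    where open ≡-mod-Reasoning 2
  1≢0 : 1 ≢ 0
  1≢0 ()

toℕ∈? : ∀ {n} (xs : List ℕ) → Decidable (λ (x : Fin n) → toℕ x ∈ xs)
toℕ∈? xs x = any? (toℕ x ≟_) xs

restrictedSumsetSize<n : ∀ {n} .{{_ : NonZero n}} M j → n ≡ 2 mod 4 →
  binomSum (suc M) (suc j) ≡ n → binomSum M j ≡ 0 mod 2 → (a : Fin (suc M) → Fin n) →
  restrictedSumsetSize n (suc j) a < n
restrictedSumsetSize<n {n} M j n≡2 |choices|≡n binomSum-even a
  with all? (toℕ∈? (restrictedSums n (suc j) a)) (allFin n)
... | yes all-hit = ⊥-elim (restrictedSums-incomplete M j n≡2 |choices|≡n binomSum-even a cover)
  where
  cover : ∀ x → x < n → x ∈ restrictedSums n (suc j) a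
  cover x x<n = subst (_∈ restrictedSums n (suc j) a) (toℕ-fromℕ< x<n) (All.lookup all-hit (∈-allFin (fromℕ< x<n)))
... | no ¬all-hit = <-≤-trans (filter-notAll (toℕ∈? _) (allFin n) (¬All⇒Any¬ (toℕ∈? _) (allFin n) ¬all-hit))
                               (≤-reflexive (length-tabulate id))

foldr-⊔-< : ∀ {A : Set} {n} (f : A → ℕ) → 0 < n → (∀ x → f x < n) → ∀ xs → foldr (λ x r → f x ⊔ r) 0 xs < n
foldr-⊔-< f 0<n f<n []       = 0<n
foldr-⊔-< f 0<n f<n (x ∷ xs) = ⊔-lub (f<n x) (foldr-⊔-< f 0<n f<n xs)

νZ<n : ∀ {n} .{{_ : NonZero n}} m h → 1 ≤ m → 1 ≤ h → n ≡ 2 mod 4 →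
       binomSum m h ≡ n → binomSum (pred m) (pred h) ≡ 0 mod 2 → νZ n m h < n
νZ<n {n} (suc M) (suc j) _ _ n≡2 |choices|≡n binomSum-even =
  foldr-⊔-< (λ A → restrictedSumsetSize n (suc j) (lookup A)) (>-nonZero⁻¹ n)
    (λ A → restrictedSumsetSize<n M j n≡2 |choices|≡n binomSum-even (lookup A)) (mSubsets n (suc M))

theorem1p7 : (k h : ℕ) → 2 ≤ h →
    νZ (binomSum (mOf k h) h) {{binomSum-nonZero (mOf k h) h}} (mOf k h) h
      < binomSum (mOf k h) h ⊓ binomSum (mOf k h) h
theorem1p7 k h 2≤h = <-≤-trans
  (νZ<n {{binomSum-nonZero m h}} m h (2^t*w>0 w≡3 ⌊log₂ h ⌋) (<-trans z<s 2≤h) n≡2 refl binomSum-even)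
  (≤-reflexive (sym (⊓-idem n)))
  where
  m n : ℕ
  m = mOf k h
  n = binomSum m h
  w≡3 : 4 * k + 3 ≡ 3 mod 4
  w≡3 = trans-mod (≡⇒≡-mod (trans (+-comm (4 * k) 3) (cong (3 +_) (*-comm 4 k)))) (m+kd≡m-mod 3 k)
  binomSum-even : binomSum (pred m) (pred h) ≡ 0 mod 2
  binomSum-even = proj₁ (binomSum-2^⌊log₂h⌋*w w≡3 h 2≤h)
  n≡2 : n ≡ 2 mod 4
  n≡2 = proj₂ (binomSum-2^⌊log₂h⌋*w w≡3 h 2≤h)
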